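{- Every ring of butterflies with at least $6$ links is independent.
   Context: All graphs are finite and simple. Independence refers to the 3-dimensional generic rigidity matroid $\mathcal{R}_3$: $G$ is independent if $\mathrm{rank}(G)=|E(G)|$. Ring: given $m\ge 3$ vertex-disjoint graphs $G_1,\dots,G_m$ (links), each with four distinct hinge vertices $a_i,b_i,c_i,d_i$, the ring $R(G_1,\dots,G_m)$ is obtained by identifying $a_1$ with $c_m$, $b_1$ with $d_m$, and, for $1\le i\le m-1$, $c_i$ with $a_{i+1}$ and $d_i$ with $b_{i+1}$; the pairs $(a_i,b_i)$, $(c_i,d_i)$ are the hinges. A butterfly is $K_5$ with two non-incident edges deleted; a ring of butterflies is a ring all of whose links are butterflies, where in each link the two hinges are the two deleted edges. -}

module Defs where

open import Data.Nat using (ℕ; zero; suc)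
open import Data.Nat.DivMod using (_%_; m%n<n)
open import Data.Fin using (Fin; zero; suc; toℕ; fromℕ<; _≟_)
open import Data.Rational using (ℚ; 0ℚ; 1ℚ; _+_; _*_; _-_)
open import Data.Product using (_×_; _,_; proj₁; proj₂; Σ; ∃; ∃₂)
open import Data.Sum using (_⊎_)
open import Function.Definitions using (Injective; Surjective)
open import Relation.Nullary using (yes; no)
open import Relation.Binary.PropositionalEquality using (_≡_; _≢_)

SameEdge : ∀ {n} → Fin n × Fin n → Fin n × Fin n → Set
SameEdge (a , b) (c , d) = (a ≡ c × b ≡ d) ⊎ (a ≡ d × b ≡ c)

record Graph : Set where
  field
    nV   : ℕ
    nE   : ℕ
    ends : Fin nE → Fin nV × Fin nV
    loopless : ∀ e → proj₁ (ends e) ≢ proj₂ (ends e)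
    noMulti  : ∀ e f → SameEdge (ends e) (ends f) → e ≡ f
open Graph public

ΣFin : (k : ℕ) → (Fin k → ℚ) → ℚ
ΣFin zero    f = 0ℚ
ΣFin (suc k) f = f zero + ΣFin k (λ i → f (suc i))

δ : ∀ {n} → Fin n → Fin n → ℚ
δ w i with w ≟ i
... | yes _ = 1ℚ
... | no  _ = 0ℚ

Realization : ℕ → Set
Realization n = Fin n → Fin 3 → ℚ

-- entry of the rigidity matrix R(G,p) in the row of edge e = ij
-- and the column (w , c): (p_i - p_j)_c if w = i, (p_j - p_i)_c if w = j, 0 else
rigidityEntry : (G : Graph) → Realization (nV G) → Fin (nE G) → Fin (nV G) → Fin 3 → ℚ
rigidityEntry G p e w c =
  (δ w (proj₁ (ends G e)) - δ w (proj₂ (ends G e)))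
    * (p (proj₁ (ends G e)) c - p (proj₂ (ends G e)) c)

RowsIndependent : (G : Graph) → Realization (nV G) → Set
RowsIndependent G p =
  (λe : Fin (nE G) → ℚ) →
  (∀ w c → ΣFin (nE G) (λ e → λe e * rigidityEntry G p e w c) ≡ 0ℚ) →
  ∀ e → λe e ≡ 0ℚ

-- G is independent in the generic 3-dimensional rigidity matroid:
-- the rigidity matrix has full row rank |E| at a (equivalently, generic) realization
Independent3 : Graph → Set
Independent3 G = ∃ λ (p : Realization (nV G)) → RowsIndependent G p

next : ∀ {k} → Fin k → Fin k
next {suc k} i = fromℕ< (m%n<n (suc (toℕ i)) (suc k))

-- labels of the vertices of a ring of k butterflies:
--   (i , 0) = a_i , (i , 1) = b_i   (the hinge (a_i,b_i) = (c_{i-1},d_{i-1}))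
--   (i , 2) = the fifth vertex of the i-th butterfly
-- so link i has hinge vertices a_i=(i,0), b_i=(i,1), c_i=(i+1,0), d_i=(i+1,1).
Lab : ℕ → Set
Lab k = Fin k × Fin 3

-- edges of the i-th butterfly: K_5 on {a_i,b_i,c_i,d_i,x_i} minus a_i b_i and c_i d_i
data RingEdge {k : ℕ} : Lab k → Lab k → Set where
  xa : ∀ i → RingEdge (i , suc (suc zero)) (i , zero)
  xb : ∀ i → RingEdge (i , suc (suc zero)) (i , suc zero)
  xc : ∀ i → RingEdge (i , suc (suc zero)) (next i , zero)
  xd : ∀ i → RingEdge (i , suc (suc zero)) (next i , suc zero)
  ac : ∀ i → RingEdge (i , zero)     (next i , zero)
  ad : ∀ i → RingEdge (i , zero)     (next i , suc zero)
  bc : ∀ i → RingEdge (i , suc zero) (next i , zero)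
  bd : ∀ i → RingEdge (i , suc zero) (next i , suc zero)

record IsRingOfButterflies (G : Graph) (k : ℕ) : Set where
  field
    φ       : Lab k → Fin (nV G)
    φ-inj   : Injective _≡_ _≡_ φ
    φ-surj  : Surjective _≡_ _≡_ φ
    edgeSound    : ∀ e → ∃₂ λ s t → RingEdge s t × SameEdge (ends G e) (φ s , φ t)
    edgeComplete : ∀ s t → RingEdge s t → ∃ λ e → SameEdge (ends G e) (φ s , φ t)

-- A self-stress ω of a framework (G , p), i.e. a row dependency of its rigidity matrix, is
-- orthogonal to the image of that matrix: Σₑ ω e ⟨p u − p v , N u − N v⟩ = 0 for every velocity
-- field N.  So ω vanishes on an edge as soon as some N stretches that edge and no other edge on
-- which ω may be nonzero.  Realising the ring with explicit rational coordinates, we clear its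
-- links one at a time.  Link 1 is cleared by eight motions of the chain of links 0, …, 4 that fix
-- a₀, b₀ and the block of link 5; they stretch nothing outside that chain because, when the ring
-- has at least six links, the blocks 0, …, 5 are distinct.  Link n is then cleared from link n − 1
-- by moving only a_n, b_n, x_n: with its far hinge c_n, d_n pinned, the eight edges of a
-- butterfly are independent, as explicit cross-product motions show.

module Submission where

open import Defs
open import Algebra.Bundles using (CommutativeRing)
open import Data.Fin as Fin using (Fin; zero; suc; toℕ; punchIn)
open import Data.Fin.Patterns
open import Data.Fin.Properties using (all?; punchInᵢ≢i; toℕ-fromℕ<; toℕ-injective; toℕ<n)
open import Data.Nat as ℕ using (ℕ; zero; suc; _<_; _≤_; _%_; z≤n; s≤s)
open import Data.Nat.DivMod using (m≤n⇒m%n≡m; %-congˡ; n%n≡0; m%n<n)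
import Data.Nat.Properties as ℕP
open import Data.Product as Product using (_×_; _,_; proj₁; proj₂; Σ-syntax)
open import Data.Rational using (ℚ; 0ℚ; 1ℚ; _+_; _*_; _-_; -_; 1/_; ≢-nonZero)
import Data.Rational.Properties as ℚP
open import Data.Rational.Solver using (module +-*-Solver)
open import Data.Sum using (_⊎_; inj₁; inj₂)
open import Data.Unit using (tt)
open import Data.Vec.Functional using (Vector; _∷_; [])
open import Function using (_∘_)
open import Relation.Binary.PropositionalEquality
open import Relation.Nullary using (Dec; yes; no; ¬?; _×-dec_; _→-dec_; contradiction)
open import Relation.Nullary.Decidable using (True; toWitness; from-yes; map′)

open import Algebra.Properties.Semiring.Sum (CommutativeRing.semiring ℚP.+-*-commutativeRing)
  using (sum; sum-syntax; sum-cong-≗; sum-replicate-zero; sum-remove; ∑-distrib-+; ∑-comm;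
         *-distribˡ-sum; *-distribʳ-sum)

open +-*-Solver using (solve; _:+_; _:*_; _:-_; :-_; _:=_)

ΣFin≡sum : ∀ n (f : Vector ℚ n) → ΣFin n f ≡ sum f
ΣFin≡sum zero    f = refl
ΣFin≡sum (suc n) f = cong (f zero +_) (ΣFin≡sum n (f ∘ suc))

sum-zero : ∀ {n} {f : Vector ℚ n} → (∀ i → f i ≡ 0ℚ) → sum f ≡ 0ℚ
sum-zero {n} f≗0 = trans (sum-cong-≗ f≗0) (sum-replicate-zero n)

sum-concentrated : ∀ {n} (f : Vector ℚ n) i → (∀ j → j ≢ i → f j ≡ 0ℚ) → sum f ≡ f i
sum-concentrated {suc n} f i vanishes = begin
  sum f                             ≡⟨ sum-remove f ⟩
  f i + ∑[ j < n ] f (punchIn i j)  ≡⟨ cong (f i +_) (sum-zero (λ j → vanishes _ (punchInᵢ≢i i j))) ⟩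
  f i + 0ℚ                          ≡⟨ ℚP.+-identityʳ (f i) ⟩
  f i                               ∎
  where open ≡-Reasoning

sum-*-δ : ∀ {n} (f : Vector ℚ n) u → ∑[ w < n ] (f w * δ w u) ≡ f u
sum-*-δ f u = begin
  ∑[ w < _ ] (f w * δ w u)  ≡⟨ sum-concentrated _ u (λ w w≢u → trans (cong (f w *_) (δ-≢ w≢u)) (ℚP.*-zeroʳ (f w))) ⟩
  f u * δ u u               ≡⟨ cong (f u *_) (δ-refl u) ⟩
  f u * 1ℚ                  ≡⟨ ℚP.*-identityʳ (f u) ⟩
  f u                       ∎
  where
  open ≡-Reasoning
  δ-refl : ∀ {n} (u : Fin n) → δ u u ≡ 1ℚ
  δ-refl u with u Fin.≟ u
  ... | yes _   = refl
  ... | no u≢u = contradiction refl u≢u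
  δ-≢ : ∀ {n} {w u : Fin n} → w ≢ u → δ w u ≡ 0ℚ
  δ-≢ {w = w} {u} w≢u with w Fin.≟ u
  ... | yes w≡u = contradiction w≡u w≢u
  ... | no _    = refl

p*q≡0∧q≢0⇒p≡0 : ∀ {p q} → p * q ≡ 0ℚ → q ≢ 0ℚ → p ≡ 0ℚ
p*q≡0∧q≢0⇒p≡0 {p} {q} pq≡0 q≢0 = begin
  p               ≡⟨ ℚP.*-identityʳ p ⟨
  p * 1ℚ          ≡⟨ cong (p *_) (ℚP.*-inverseʳ q) ⟨
  p * (q * 1/ q)  ≡⟨ ℚP.*-assoc p q (1/ q) ⟨
  (p * q) * 1/ q  ≡⟨ cong (_* 1/ q) pq≡0 ⟩
  0ℚ * 1/ q       ≡⟨ ℚP.*-zeroˡ (1/ q) ⟩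
  0ℚ              ∎
  where
  open ≡-Reasoning
  instance _ = ≢-nonZero q≢0

-- Self-stresses

Point : Set
Point = Vector ℚ 3

_-ᵥ_ : Point → Point → Point
(u -ᵥ v) c = u c - v c

_·_ : Point → Point → ℚ
u · v = ∑[ c < 3 ] (u c * v c)

-- The entry of R(G , p) N in the row of the edge u v.
stretch : {V : Set} → (V → Point) → (V → Point) → V × V → ℚ
stretch p N (u , v) = (p u -ᵥ p v) · (N u -ᵥ N v)

IsSelfStress : (G : Graph) → Realization (nV G) → (Fin (nE G) → ℚ) → Set
IsSelfStress G p ω = ∀ w c → ΣFin (nE G) (λ e → ω e * rigidityEntry G p e w c) ≡ 0ℚ

module _ (G : Graph) (p : Realization (nV G)) where

  rigidityEntry-pairing : ∀ (N : Realization (nV G)) e c →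
    let (u , v) = ends G e in
    ∑[ w < nV G ] (N w c * rigidityEntry G p e w c) ≡ (p u c - p v c) * (N u c - N v c)
  rigidityEntry-pairing N e c = begin
    ∑[ w < nV G ] (N w c * ((δ w u - δ w v) * d))
      ≡⟨ sum-cong-≗ (λ w → split (N w c) (δ w u) (δ w v) d) ⟩
    ∑[ w < nV G ] ((N w c * δ w u) * d + (N w c * δ w v) * (- d))
      ≡⟨ ∑-distrib-+ (λ w → (N w c * δ w u) * d) (λ w → (N w c * δ w v) * (- d)) ⟩
    ∑[ w < nV G ] ((N w c * δ w u) * d) + ∑[ w < nV G ] ((N w c * δ w v) * (- d))
      ≡⟨ cong₂ _+_ (*-distribʳ-sum d (λ w → N w c * δ w u)) (*-distribʳ-sum (- d) (λ w → N w c * δ w v)) ⟨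
    ∑[ w < nV G ] (N w c * δ w u) * d + ∑[ w < nV G ] (N w c * δ w v) * (- d)
      ≡⟨ cong₂ (λ x y → x * d + y * (- d)) (sum-*-δ (λ w → N w c) u) (sum-*-δ (λ w → N w c) v) ⟩
    N u c * d + N v c * (- d)
      ≡⟨ collect (N u c) (N v c) d ⟩
    d * (N u c - N v c) ∎
    where
    open ≡-Reasoning
    u v : Fin (nV G)
    u = proj₁ (ends G e)
    v = proj₂ (ends G e)
    d : ℚ
    d = p u c - p v c
    split : ∀ n x y d → n * ((x - y) * d) ≡ (n * x) * d + (n * y) * (- d)
    split = solve 4 (λ n x y d → n :* ((x :- y) :* d) := (n :* x) :* d :+ (n :* y) :* (:- d)) refl
    collect : ∀ a b d → a * d + b * (- d) ≡ d * (a - b)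
    collect = solve 3 (λ a b d → a :* d :+ b :* (:- d) := d :* (a :- b)) refl

  selfStress-orthogonal : ∀ {ω} → IsSelfStress G p ω →
    ∀ N → ∑[ e < nE G ] (ω e * stretch p N (ends G e)) ≡ 0ℚ
  selfStress-orthogonal {ω} isStress N = begin
    ∑[ e < nE G ] (ω e * stretch p N (ends G e))
      ≡⟨ sum-cong-≗ (λ e → trans (*-distribˡ-sum (ω e) (summand e)) (sum-cong-≗ (expand e))) ⟩
    ∑[ e < nE G ] ∑[ c < 3 ] ∑[ w < nV G ] term e c w
      ≡⟨ sum-cong-≗ (λ e → ∑-comm (term e)) ⟩
    ∑[ e < nE G ] ∑[ w < nV G ] ∑[ c < 3 ] term e c w
      ≡⟨ ∑-comm (λ e w → ∑[ c < 3 ] term e c w) ⟩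
    ∑[ w < nV G ] ∑[ e < nE G ] ∑[ c < 3 ] term e c w
      ≡⟨ sum-cong-≗ (λ w → ∑-comm (λ e c → term e c w)) ⟩
    ∑[ w < nV G ] ∑[ c < 3 ] ∑[ e < nE G ] term e c w
      ≡⟨ sum-cong-≗ (λ w → sum-cong-≗ (λ c → *-distribˡ-sum (N w c) (λ e → ω e * rigidityEntry G p e w c))) ⟨
    ∑[ w < nV G ] ∑[ c < 3 ] (N w c * ∑[ e < nE G ] (ω e * rigidityEntry G p e w c))
      ≡⟨ sum-zero (λ w → sum-zero (λ c → trans (cong (N w c *_) (stress w c)) (ℚP.*-zeroʳ (N w c)))) ⟩
    0ℚ ∎
    where
    open ≡-Reasoning
    term : Fin (nE G) → Fin 3 → Fin (nV G) → ℚ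
    term e c w = N w c * (ω e * rigidityEntry G p e w c)
    summand : Fin (nE G) → Fin 3 → ℚ
    summand e c = let (u , v) = ends G e in (p u -ᵥ p v) c * (N u -ᵥ N v) c
    swap-factors : ∀ x y z → x * (y * z) ≡ y * (x * z)
    swap-factors = solve 3 (λ x y z → x :* (y :* z) := y :* (x :* z)) refl
    expand : ∀ e c → ω e * summand e c ≡ ∑[ w < nV G ] term e c w
    expand e c = begin
      ω e * summand e c                                       ≡⟨ cong (ω e *_) (rigidityEntry-pairing N e c) ⟨
      ω e * ∑[ w < nV G ] (N w c * rigidityEntry G p e w c)   ≡⟨ *-distribˡ-sum (ω e) (λ w → N w c * rigidityEntry G p e w c) ⟩
      ∑[ w < nV G ] (ω e * (N w c * rigidityEntry G p e w c)) ≡⟨ sum-cong-≗ (λ w → swap-factors (ω e) (N w c) _) ⟩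
      ∑[ w < nV G ] term e c w                                ∎
    stress : ∀ w c → ∑[ e < nE G ] (ω e * rigidityEntry G p e w c) ≡ 0ℚ
    stress w c = trans (sym (ΣFin≡sum (nE G) _)) (isStress w c)

  selfStress-vanishes-at : ∀ {ω} → IsSelfStress G p ω → ∀ N e₀ →
    stretch p N (ends G e₀) ≢ 0ℚ →
    (∀ e → e ≢ e₀ → ω e * stretch p N (ends G e) ≡ 0ℚ) →
    ω e₀ ≡ 0ℚ
  selfStress-vanishes-at {ω} isStress N e₀ stretched others = p*q≡0∧q≢0⇒p≡0 ω₀s₀≡0 stretched
    where
    ω₀s₀≡0 : ω e₀ * stretch p N (ends G e₀) ≡ 0ℚ
    ω₀s₀≡0 = trans (sym (sum-concentrated (λ e → ω e * stretch p N (ends G e)) e₀ others))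
                   (selfStress-orthogonal {ω} isStress N)

stretch-swap : ∀ {V : Set} (p N : V → Point) u v → stretch p N (v , u) ≡ stretch p N (u , v)
stretch-swap p N u v = sum-cong-≗ (λ c → flip (p v c) (p u c) (N v c) (N u c))
  where
  flip : ∀ a b c d → (a - b) * (c - d) ≡ (b - a) * (d - c)
  flip = solve 4 (λ a b c d → (a :- b) :* (c :- d) := (b :- a) :* (d :- c)) refl

SameEdge-sym : ∀ {n} {x y : Fin n × Fin n} → SameEdge x y → SameEdge y x
SameEdge-sym (inj₁ (refl , refl)) = inj₁ (refl , refl)
SameEdge-sym (inj₂ (refl , refl)) = inj₂ (refl , refl)

SameEdge-trans : ∀ {n} {x y z : Fin n × Fin n} → SameEdge x y → SameEdge y z → SameEdge x z
SameEdge-trans (inj₁ (refl , refl)) y~z                  = y~z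
SameEdge-trans (inj₂ (refl , refl)) (inj₁ (refl , refl)) = inj₂ (refl , refl)
SameEdge-trans (inj₂ (refl , refl)) (inj₂ (refl , refl)) = inj₁ (refl , refl)

stretch-SameEdge : ∀ {n} (p N : Fin n → Point) {x y} → SameEdge x y → stretch p N x ≡ stretch p N y
stretch-SameEdge p N (inj₁ (refl , refl)) = refl
stretch-SameEdge p N (inj₂ (refl , refl)) = stretch-swap p N _ _

Still : Point → Set
Still v = ∀ c → v c ≡ 0ℚ

stretch-still : ∀ {V : Set} (p N : V → Point) {u v} → Still (N u) → Still (N v) → stretch p N (u , v) ≡ 0ℚ
stretch-still p N {u} {v} Nu≡0 Nv≡0 = sum-zero λ c → begin
  (p u c - p v c) * (N u c - N v c)  ≡⟨ cong₂ (λ x y → (p u c - p v c) * (x - y)) (Nu≡0 c) (Nv≡0 c) ⟩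
  (p u c - p v c) * 0ℚ               ≡⟨ ℚP.*-zeroʳ (p u c - p v c) ⟩
  0ℚ                                 ∎
  where open ≡-Reasoning

-- Butterflies

-- Coordinates, or velocities, of the vertices a_i, b_i, x_i, labelled (i , 0), (i , 1), (i , 2).
Block : Set
Block = Vector Point 3

rest : Block
rest _ _ = 0ℚ

rest-still : ∀ {V} → V ≡ rest → ∀ j → Still (V j)
rest-still refl _ _ = refl

-- The vertices a, b, x, c, d of the link whose own block is B; its far hinge c d is the hinge a b of B'.
linkVertex : Block → Block → Vector Point 5
linkVertex B B' = B 0F ∷ B 1F ∷ B 2F ∷ B' 0F ∷ B' 1F ∷ []

-- xa, xb, xc, xd, ac, ad, bc, bd: the order of the constructors of RingEdge.
linkEdge : Vector (Fin 5 × Fin 5) 8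
linkEdge = (2F , 0F) ∷ (2F , 1F) ∷ (2F , 3F) ∷ (2F , 4F) ∷ (0F , 3F) ∷ (0F , 4F) ∷ (1F , 3F) ∷ (1F , 4F) ∷ []

linkStretch : (P P' V V' : Block) → Vector ℚ 8
linkStretch P P' V V' κ = stretch (linkVertex P P') (linkVertex V V') (linkEdge κ)

linkStretchAt : (B V : ℕ → Block) → ℕ → ℕ → Vector ℚ 8
linkStretchAt B V n n' = linkStretch (B n) (B n') (V n) (V n')

linkStretch-still : ∀ P P' {V V'} → V ≡ rest → Still (V' 0F) → Still (V' 1F) →
                    ∀ κ → linkStretch P P' V V' κ ≡ 0ℚ
linkStretch-still P P' {V' = V'} refl c-still d-still κ =
  stretch-still (linkVertex P P') (linkVertex rest V') {u} {v} (still u) (still v)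
  where
  u v : Fin 5
  u = proj₁ (linkEdge κ)
  v = proj₂ (linkEdge κ)
  still : ∀ j → Still (linkVertex rest V' j)
  still 0F _ = refl
  still 1F _ = refl
  still 2F _ = refl
  still 3F = c-still
  still 4F = d-still

Isolates : ∀ {n} → Vector ℚ n → Fin n → Set
Isolates s i = s i ≢ 0ℚ × (∀ j → j ≢ i → s j ≡ 0ℚ)

isolates? : ∀ {n} (s : Vector ℚ n) i → Dec (Isolates s i)
isolates? s i = ¬? (s i ℚP.≟ 0ℚ) ×-dec all? (λ j → ¬? (j Fin.≟ i) →-dec s j ℚP.≟ 0ℚ)

still? : ∀ v → Dec (Still v)
still? v = all? (λ c → v c ℚP.≟ 0ℚ)

cross : Point → Point → Point
cross u v = u 1F * v 2F - u 2F * v 1F ∷ u 2F * v 0F - u 0F * v 2F ∷ u 0F * v 1F - u 1F * v 0F ∷ []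

_*ᵥ_ : ℚ → Point → Point
(s *ᵥ v) c = s * v c

-- A velocity of a vertex orthogonal to two of its edges (a cross product) stretches neither.
-- The motions for xc and xd move x orthogonally to x a and to the other one of x c, x d, and
-- compensate the stretch of x b by moving b along the normal of b c d.
pinnedMotion : Block → Block → Fin 8 → Block
pinnedMotion P P' =
    moveA (cross (a -ᵥ c) (a -ᵥ d))
  ∷ moveB n-bcd
  ∷ moveXB (cross (x -ᵥ d) (x -ᵥ a))
  ∷ moveXB (cross (x -ᵥ c) (x -ᵥ a))
  ∷ moveA (cross (a -ᵥ x) (a -ᵥ d))
  ∷ moveA (cross (a -ᵥ x) (a -ᵥ c))
  ∷ moveB (cross (b -ᵥ x) (b -ᵥ d))
  ∷ moveB (cross (b -ᵥ x) (b -ᵥ c))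
  ∷ []
  where
  a b x c d n-bcd : Point
  a = P 0F
  b = P 1F
  x = P 2F
  c = P' 0F
  d = P' 1F
  n-bcd = cross (b -ᵥ c) (b -ᵥ d)
  moveA moveB moveXB : Point → Block
  moveA v = v ∷ rest 1F ∷ rest 2F ∷ []
  moveB v = rest 0F ∷ v ∷ rest 2F ∷ []
  moveXB v = rest 0F ∷ ((x -ᵥ b) · v) *ᵥ n-bcd ∷ ((x -ᵥ b) · n-bcd) *ᵥ v ∷ []

PinnedIsolating : Block → Block → Set
PinnedIsolating P P' = ∀ κ₀ → Isolates (linkStretch P P' (pinnedMotion P P' κ₀) rest) κ₀

pinnedIsolating? : ∀ P P' → Dec (PinnedIsolating P P')
pinnedIsolating? P P' = all? (λ κ₀ → isolates? (linkStretch P P' (pinnedMotion P P' κ₀) rest) κ₀)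

blockMotion : ℕ → Block → ℕ → Block
blockMotion zero    A zero    = A
blockMotion (suc n) A (suc m) = blockMotion n A m
blockMotion _       _ _       = rest

blockMotion-≡ : ∀ n A → blockMotion n A n ≡ A
blockMotion-≡ zero    A = refl
blockMotion-≡ (suc n) A = blockMotion-≡ n A

blockMotion-≢ : ∀ {m n} A → m ≢ n → blockMotion n A m ≡ rest
blockMotion-≢ {zero}  {zero}  A 0≢0 = contradiction refl 0≢0
blockMotion-≢ {zero}  {suc n} A _   = refl
blockMotion-≢ {suc m} {zero}  A _   = refl
blockMotion-≢ {suc m} {suc n} A m≢n = blockMotion-≢ A (m≢n ∘ cong suc)

data SucMod (K m : ℕ) : ℕ → Set where
  no-wrap : suc m < K → SucMod K m (suc m)
  wrap    : suc m ≡ K → SucMod K m 0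

sucMod : ∀ {k m} → m < suc k → SucMod (suc k) m (suc m % suc k)
sucMod {k} {m} m<K with ℕP.m≤n⇒m<n∨m≡n m<K
... | inj₁ 1+m<K = subst (SucMod _ m) (sym (m≤n⇒m%n≡m (ℕP.≤-pred 1+m<K))) (no-wrap 1+m<K)
... | inj₂ 1+m≡K = subst (SucMod _ m) (sym (trans (%-congˡ {o = suc k} 1+m≡K) (n%n≡0 (suc k)))) (wrap 1+m≡K)

sucMod-injective : ∀ {k m m'} → m < suc k → m' < suc k → suc m % suc k ≡ suc m' % suc k → m ≡ m'
sucMod-injective {k} {m} {m'} m<K m'<K eq with suc m % suc k | sucMod m<K | suc m' % suc k | sucMod m'<K
... | _ | no-wrap _   | _ | no-wrap _    = ℕP.suc-injective eq
... | _ | wrap 1+m≡K | _ | wrap 1+m'≡K = ℕP.suc-injective (trans 1+m≡K (sym 1+m'≡K))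
... | _ | no-wrap _   | _ | wrap _       = contradiction eq λ ()
... | _ | wrap _      | _ | no-wrap _    = contradiction eq λ ()

sucMod-≢ : ∀ {k n} → 2 ≤ suc k → n < suc k → suc n % suc k ≢ n
sucMod-≢ {k} {n} 2≤K n<K with suc n % suc k | sucMod n<K
... | _ | no-wrap _ = ℕP.1+n≢n
... | _ | wrap 1≡K  = λ { refl → contradiction (subst (2 ≤_) (sym 1≡K) 2≤K) λ { (s≤s ()) } }

-- The realisation

⟨_,_,_⟩ : ℚ → ℚ → ℚ → Point
⟨ x , y , z ⟩ = x ∷ y ∷ z ∷ []

block : Point → Point → Point → Block
block a b x = a ∷ b ∷ x ∷ []

module Tables where
  open import Agda.Builtin.FromNat using (fromNat)
  open import Agda.Builtin.FromNeg using (fromNeg)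
  import Data.Nat.Literals as ℕLit
  import Data.Rational.Literals as ℚLit

  private instance
    _ = tt
    _ = ℕLit.number
    _ = ℚLit.number
    _ = ℚLit.negative

  configuration : Vector Block 9
  configuration =
      block ⟨ 2 , 0 , 2 ⟩ ⟨ -2 , 2 , -1 ⟩ ⟨ -1 , 3 , 3 ⟩
    ∷ block ⟨ 1 , -1 , -2 ⟩ ⟨ 1 , -2 , 2 ⟩ ⟨ -1 , -2 , -2 ⟩
    ∷ block ⟨ -1 , 2 , 2 ⟩ ⟨ 1 , 0 , 2 ⟩ ⟨ -2 , 1 , -2 ⟩
    ∷ block ⟨ -1 , 2 , 0 ⟩ ⟨ 1 , 2 , -2 ⟩ ⟨ 0 , 2 , -2 ⟩
    ∷ block ⟨ 2 , 1 , 0 ⟩ ⟨ -1 , 0 , 0 ⟩ ⟨ 0 , 2 , -2 ⟩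
    ∷ block ⟨ -1 , -1 , 0 ⟩ ⟨ -2 , -2 , 1 ⟩ ⟨ 2 , 0 , -1 ⟩
    ∷ block ⟨ 2 , -1 , 1 ⟩ ⟨ 0 , 2 , 1 ⟩ ⟨ 0 , 2 , 0 ⟩
    ∷ block ⟨ -2 , -2 , -2 ⟩ ⟨ 1 , 1 , 0 ⟩ ⟨ 1 , 0 , 2 ⟩
    ∷ block ⟨ 0 , -1 , -1 ⟩ ⟨ -1 , 2 , 0 ⟩ ⟨ 1 , -1 , -1 ⟩
    ∷ []

  windowTable : Fin 8 → Vector Block 5
  windowTable 0F =
      block ⟨ 0 , 0 , 0 ⟩ ⟨ 0 , 0 , 0 ⟩ ⟨ 418 , 494 , -228 ⟩
    ∷ block ⟨ -66 , -78 , 36 ⟩ ⟨ -228 , 114 , 380 ⟩ ⟨ -628 , -730 , 580 ⟩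
    ∷ block ⟨ -348 , 54 , -204 ⟩ ⟨ -288 , 114 , -12 ⟩ ⟨ -42 , -84 , -246 ⟩
    ∷ block ⟨ -210 , 0 , -204 ⟩ ⟨ -72 , 6 , -66 ⟩ ⟨ -72 , -64 , -135 ⟩
    ∷ block ⟨ -140 , 210 , 70 ⟩ ⟨ -70 , 0 , -70 ⟩ ⟨ -70 , -70 , -140 ⟩
    ∷ []
  windowTable 1F =
      block ⟨ 0 , 0 , 0 ⟩ ⟨ 0 , 0 , 0 ⟩ ⟨ 418 , 494 , -228 ⟩
    ∷ block ⟨ -66 , -78 , 36 ⟩ ⟨ -228 , 114 , 380 ⟩ ⟨ -36 , -138 , -12 ⟩
    ∷ block ⟨ -348 , 54 , -204 ⟩ ⟨ -288 , 114 , -12 ⟩ ⟨ -42 , -84 , -246 ⟩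
    ∷ block ⟨ -210 , 0 , -204 ⟩ ⟨ -72 , 6 , -66 ⟩ ⟨ -72 , -64 , -135 ⟩
    ∷ block ⟨ -140 , 210 , 70 ⟩ ⟨ -70 , 0 , -70 ⟩ ⟨ -70 , -70 , -140 ⟩
    ∷ []
  windowTable 2F =
      block ⟨ 0 , 0 , 0 ⟩ ⟨ 0 , 0 , 0 ⟩ ⟨ 418 , 494 , -228 ⟩
    ∷ block ⟨ -66 , -78 , 36 ⟩ ⟨ -228 , 114 , 380 ⟩ ⟨ 260 , -730 , 136 ⟩
    ∷ block ⟨ -348 , 54 , -204 ⟩ ⟨ -288 , 114 , -12 ⟩ ⟨ -42 , -84 , -246 ⟩
    ∷ block ⟨ -210 , 0 , -204 ⟩ ⟨ -72 , 6 , -66 ⟩ ⟨ -72 , -64 , -135 ⟩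
    ∷ block ⟨ -140 , 210 , 70 ⟩ ⟨ -70 , 0 , -70 ⟩ ⟨ -70 , -70 , -140 ⟩
    ∷ []
  windowTable 3F =
      block ⟨ 0 , 0 , 0 ⟩ ⟨ 0 , 0 , 0 ⟩ ⟨ -2090 , -2470 , 1140 ⟩
    ∷ block ⟨ 330 , 390 , -180 ⟩ ⟨ 1140 , -570 , -1900 ⟩ ⟨ -412 , 1874 , -1124 ⟩
    ∷ block ⟨ 1740 , -270 , 1020 ⟩ ⟨ 1440 , -570 , 60 ⟩ ⟨ 210 , 420 , 1230 ⟩
    ∷ block ⟨ 1050 , 0 , 1020 ⟩ ⟨ 360 , -30 , 330 ⟩ ⟨ 360 , 320 , 675 ⟩
    ∷ block ⟨ 700 , -1050 , -350 ⟩ ⟨ 350 , 0 , 350 ⟩ ⟨ 350 , 350 , 700 ⟩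
    ∷ []
  windowTable 4F =
      block ⟨ 0 , 0 , 0 ⟩ ⟨ 0 , 0 , 0 ⟩ ⟨ -8646 , -10218 , 4716 ⟩
    ∷ block ⟨ 5478 , 6474 , -2988 ⟩ ⟨ 4716 , -2358 , -7860 ⟩ ⟨ 4764 , 7902 , -7884 ⟩
    ∷ block ⟨ -3084 , -6258 , 6276 ⟩ ⟨ 816 , -2358 , -780 ⟩ ⟨ -2730 , 4308 , 3546 ⟩
    ∷ block ⟨ -3882 , 0 , 6276 ⟩ ⟨ -4680 , 10158 , 5478 ⟩ ⟨ -4680 , 8864 , 5877 ⟩
    ∷ block ⟨ -2588 , 3882 , 1294 ⟩ ⟨ -1294 , 0 , -1294 ⟩ ⟨ -1294 , -1294 , -2588 ⟩
    ∷ []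
  windowTable 5F =
      block ⟨ 0 , 0 , 0 ⟩ ⟨ 0 , 0 , 0 ⟩ ⟨ -3234 , -3822 , 1764 ⟩
    ∷ block ⟨ 7194 , 8502 , -3924 ⟩ ⟨ 1764 , -882 , -2940 ⟩ ⟨ 7476 , 7938 , -5796 ⟩
    ∷ block ⟨ 5964 , 1218 , 924 ⟩ ⟨ 3864 , -882 , 420 ⟩ ⟨ 1470 , -168 , 2394 ⟩
    ∷ block ⟨ 4242 , 0 , 924 ⟩ ⟨ 2520 , -3318 , -798 ⟩ ⟨ 2520 , -1904 , 63 ⟩
    ∷ block ⟨ 2828 , -4242 , -1414 ⟩ ⟨ 1414 , 0 , 1414 ⟩ ⟨ 1414 , 1414 , 2828 ⟩
    ∷ []
  windowTable 6F =
      block ⟨ 0 , 0 , 0 ⟩ ⟨ 0 , 0 , 0 ⟩ ⟨ -8646 , -10218 , 4716 ⟩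
    ∷ block ⟨ 5478 , 6474 , -2988 ⟩ ⟨ 4716 , -2358 , -7860 ⟩ ⟨ 4764 , 7902 , -7884 ⟩
    ∷ block ⟨ 2244 , -930 , 948 ⟩ ⟨ 816 , -2358 , -780 ⟩ ⟨ -66 , 1644 , 882 ⟩
    ∷ block ⟨ 1446 , 0 , 948 ⟩ ⟨ 648 , -498 , 150 ⟩ ⟨ 648 , -16 , 549 ⟩
    ∷ block ⟨ 964 , -1446 , -482 ⟩ ⟨ 482 , 0 , 482 ⟩ ⟨ 482 , 482 , 964 ⟩
    ∷ []
  windowTable 7F =
      block ⟨ 0 , 0 , 0 ⟩ ⟨ 0 , 0 , 0 ⟩ ⟨ 16302 , 19266 , -8892 ⟩
    ∷ block ⟨ -12342 , -14586 , 6732 ⟩ ⟨ -8892 , 4446 , 14820 ⟩ ⟨ -10284 , -18702 , 15516 ⟩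
    ∷ block ⟨ -11796 , 2994 , -6180 ⟩ ⟨ -7680 , 7110 , 1308 ⟩ ⟨ -750 , -5052 , -6930 ⟩
    ∷ block ⟨ -7302 , 0 , -6180 ⟩ ⟨ -2808 , 1122 , -1686 ⟩ ⟨ -2808 , -1312 , -3933 ⟩
    ∷ block ⟨ -4868 , 7302 , 2434 ⟩ ⟨ -2434 , 0 , -2434 ⟩ ⟨ -2434 , -2434 , -4868 ⟩
    ∷ []

open Tables

-- Configurations 0, 1, …, 6, then alternately 7 and 8; since each of 5, …, 8 may precede
-- configuration 0, the sequence closes up around a ring of any length at least 6.
shape : ℕ → Fin 9
shape 0 = 0F
shape 1 = 1F
shape 2 = 2F
shape 3 = 3F
shape 4 = 4F
shape 5 = 5F
shape 6 = 6F
shape 7 = 7F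
shape 8 = 8F
shape (suc (suc n@(suc (suc (suc (suc (suc (suc (suc _))))))))) = shape n

position : ℕ → Block
position n = configuration (shape n)

data _↝_ : Fin 9 → Fin 9 → Set where
  0↝1 : 0F ↝ 1F
  2↝3 : 2F ↝ 3F
  3↝4 : 3F ↝ 4F
  4↝5 : 4F ↝ 5F
  5↝6 : 5F ↝ 6F
  6↝7 : 6F ↝ 7F
  7↝8 : 7F ↝ 8F
  8↝7 : 8F ↝ 7F
  5↝0 : 5F ↝ 0F
  6↝0 : 6F ↝ 0F
  7↝0 : 7F ↝ 0F
  8↝0 : 8F ↝ 0F

shape-↝-suc : ∀ n → n ≢ 1 → shape n ↝ shape (suc n)
shape-↝-suc 0 _ = 0↝1
shape-↝-suc 1 1≢1 = contradiction refl 1≢1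
shape-↝-suc 2 _ = 2↝3
shape-↝-suc 3 _ = 3↝4
shape-↝-suc 4 _ = 4↝5
shape-↝-suc 5 _ = 5↝6
shape-↝-suc 6 _ = 6↝7
shape-↝-suc 7 _ = 7↝8
shape-↝-suc 8 _ = 8↝7
shape-↝-suc (suc (suc n@(suc (suc (suc (suc (suc (suc (suc _))))))))) _ = shape-↝-suc n (λ ())

shape-↝-0 : ∀ m → shape (5 ℕ.+ m) ↝ 0F
shape-↝-0 0 = 5↝0
shape-↝-0 1 = 6↝0
shape-↝-0 2 = 7↝0
shape-↝-0 3 = 8↝0
shape-↝-0 (suc (suc m@(suc (suc _)))) = shape-↝-0 m

shape-↝-step : ∀ {k n} → 6 ≤ suc k → n < suc k → n ≢ 1 → shape n ↝ shape (suc n % suc k)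
shape-↝-step {k} {n} 6≤K n<K n≢1 with suc n % suc k | sucMod n<K
... | _ | no-wrap _ = shape-↝-suc n n≢1
... | _ | wrap 1+n≡K with m , refl ← ℕP.m≤n⇒∃[o]m+o≡n (ℕP.≤-pred (subst (6 ≤_) (sym 1+n≡K) 6≤K)) = shape-↝-0 m

pinned-isolating-checked : ∀ {t t'} → t ↝ t' → True (pinnedIsolating? (configuration t) (configuration t'))
pinned-isolating-checked 0↝1 = tt
pinned-isolating-checked 2↝3 = tt
pinned-isolating-checked 3↝4 = tt
pinned-isolating-checked 4↝5 = tt
pinned-isolating-checked 5↝6 = tt
pinned-isolating-checked 6↝7 = tt
pinned-isolating-checked 7↝8 = tt
pinned-isolating-checked 8↝7 = tt
pinned-isolating-checked 5↝0 = tt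
pinned-isolating-checked 6↝0 = tt
pinned-isolating-checked 7↝0 = tt
pinned-isolating-checked 8↝0 = tt

pinned-isolating : ∀ {t t'} → t ↝ t' → PinnedIsolating (configuration t) (configuration t')
pinned-isolating t↝t' = toWitness (pinned-isolating-checked t↝t')

window : Fin 8 → ℕ → Block
window κ₀ 0 = windowTable κ₀ 0F
window κ₀ 1 = windowTable κ₀ 1F
window κ₀ 2 = windowTable κ₀ 2F
window κ₀ 3 = windowTable κ₀ 3F
window κ₀ 4 = windowTable κ₀ 4F
window κ₀ (suc (suc (suc (suc (suc _))))) = rest

window-beyond : ∀ κ₀ {n} → 5 ≤ n → window κ₀ n ≡ rest
window-beyond κ₀ (s≤s (s≤s (s≤s (s≤s (s≤s _))))) = refl

record WindowIsolates (κ₀ : Fin 8) : Set where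
  field
    a₀-still : Still (window κ₀ 0 0F)
    b₀-still : Still (window κ₀ 0 1F)
    link₁    : Isolates (linkStretchAt position (window κ₀) 1 2) κ₀
    others   : ∀ {n} → n < 5 → n ≢ 1 → ∀ κ → linkStretchAt position (window κ₀) n (suc n) κ ≡ 0ℚ

windowIsolates? : ∀ κ₀ → Dec (WindowIsolates κ₀)
windowIsolates? κ₀ =
  map′ (λ (a , b , l , o) → record { a₀-still = a ; b₀-still = b ; link₁ = l ; others = λ {n} → o {n} })
       (λ w → let open WindowIsolates w in a₀-still , b₀-still , link₁ , λ {n} → others {n})
       (still? _ ×-dec still? _ ×-dec isolates? _ κ₀ ×-dec
        ℕP.allUpTo? (λ n → ¬? (n ℕ.≟ 1) →-dec all? (λ κ → linkStretchAt position (window κ₀) n (suc n) κ ℚP.≟ 0ℚ)) 5)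

window-isolates : ∀ κ₀ → WindowIsolates κ₀
window-isolates = from-yes (all? windowIsolates?)

-- Rings of butterflies

module RingOfButterflies {G : Graph} {k : ℕ} (ring : IsRingOfButterflies G (suc k)) where
  open IsRingOfButterflies ring

  private
    K : ℕ
    K = suc k

  linkLabel : Fin K → Vector (Lab K) 5
  linkLabel i = (i , 0F) ∷ (i , 1F) ∷ (i , 2F) ∷ (next i , 0F) ∷ (next i , 1F) ∷ []

  linkEnds : Fin K × Fin 8 → Lab K × Lab K
  linkEnds (i , κ) = Product.map (linkLabel i) (linkLabel i) (linkEdge κ)

  φ² : Lab K × Lab K → Fin (nV G) × Fin (nV G)
  φ² = Product.map φ φ

  locate : ∀ {x s t} → RingEdge s t → SameEdge x (φ s , φ t) → Σ[ c ∈ Fin K × Fin 8 ] SameEdge x (φ² (linkEnds c))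
  locate (xa i) x~st = (i , 0F) , x~st
  locate (xb i) x~st = (i , 1F) , x~st
  locate (xc i) x~st = (i , 2F) , x~st
  locate (xd i) x~st = (i , 3F) , x~st
  locate (ac i) x~st = (i , 4F) , x~st
  locate (ad i) x~st = (i , 5F) , x~st
  locate (bc i) x~st = (i , 6F) , x~st
  locate (bd i) x~st = (i , 7F) , x~st

  linkEdgeOf : ∀ e → Σ[ c ∈ Fin K × Fin 8 ] SameEdge (ends G e) (φ² (linkEnds c))
  linkEdgeOf e = let _ , _ , st , e~st = edgeSound e in locate st e~st

  linkOf : Fin (nE G) → ℕ
  linkOf e = toℕ (proj₁ (proj₁ (linkEdgeOf e)))

  kindOf : Fin (nE G) → Fin 8
  kindOf e = proj₂ (proj₁ (linkEdgeOf e))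

  linkEdgeOf-injective : ∀ {e f} → (linkOf e , kindOf e) ≡ (linkOf f , kindOf f) → e ≡ f
  linkEdgeOf-injective {e} {f} eq = noMulti G e f (SameEdge-trans (proj₂ (linkEdgeOf e)) (SameEdge-sym f~e))
    where
    same-code : proj₁ (linkEdgeOf f) ≡ proj₁ (linkEdgeOf e)
    same-code = sym (cong₂ _,_ (toℕ-injective (cong proj₁ eq)) (cong proj₂ eq))
    f~e : SameEdge (ends G f) (φ² (linkEnds (proj₁ (linkEdgeOf e))))
    f~e = subst (λ c → SameEdge (ends G f) (φ² (linkEnds c))) same-code (proj₂ (linkEdgeOf f))

  lab : Fin (nV G) → Lab K
  lab v = proj₁ (φ-surj v)

  lab-φ : ∀ s → lab (φ s) ≡ s
  lab-φ s = φ-inj (proj₂ (φ-surj (φ s)) refl)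

  labelled : (ℕ → Block) → Lab K → Point
  labelled B (i , j) = B (toℕ i) j

  ringRealization : (ℕ → Block) → Realization (nV G)
  ringRealization B = labelled B ∘ lab

  stretch-linkEnds : ∀ B V i κ →
    stretch (labelled B) (labelled V) (linkEnds (i , κ)) ≡ linkStretchAt B V (toℕ i) (toℕ (next i)) κ
  stretch-linkEnds B V i 0F = refl
  stretch-linkEnds B V i 1F = refl
  stretch-linkEnds B V i 2F = refl
  stretch-linkEnds B V i 3F = refl
  stretch-linkEnds B V i 4F = refl
  stretch-linkEnds B V i 5F = refl
  stretch-linkEnds B V i 6F = refl
  stretch-linkEnds B V i 7F = refl

  stretch-ring : ∀ B V e →
    stretch (ringRealization B) (ringRealization V) (ends G e) ≡ linkStretchAt B V (linkOf e) (suc (linkOf e) % K) (kindOf e)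
  stretch-ring B V e = begin
    stretch (ringRealization B) (ringRealization V) (ends G e)
      ≡⟨ stretch-SameEdge (ringRealization B) (ringRealization V) e~c ⟩
    stretch (ringRealization B) (ringRealization V) (φ² (linkEnds (i , κ)))
      ≡⟨ cong₂ (λ s t → stretch (labelled B) (labelled V) (s , t)) (lab-φ _) (lab-φ _) ⟩
    stretch (labelled B) (labelled V) (linkEnds (i , κ))
      ≡⟨ stretch-linkEnds B V i κ ⟩
    linkStretchAt B V (toℕ i) (toℕ (next i)) κ
      ≡⟨ cong (λ n' → linkStretchAt B V (toℕ i) n' κ) (toℕ-fromℕ< _) ⟩
    linkStretchAt B V (toℕ i) (suc (toℕ i) % K) κ ∎
    where
    open ≡-Reasoning
    i : Fin K
    i = proj₁ (proj₁ (linkEdgeOf e))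
    κ : Fin 8
    κ = proj₂ (proj₁ (linkEdgeOf e))
    e~c : SameEdge (ends G e) (φ² (linkEnds (i , κ)))
    e~c = proj₂ (linkEdgeOf e)

  module Clearing (B : ℕ → Block) {ω : Fin (nE G) → ℚ} (ω-stress : IsSelfStress G (ringRealization B) ω) where

    Cleared : ℕ → Set
    Cleared n = ∀ e → linkOf e ≡ n → ω e ≡ 0ℚ

    cleared-by : (M : Fin 8 → ℕ → Block) → ∀ n₀ →
      (∀ κ₀ → linkStretchAt B (M κ₀) n₀ (suc n₀ % K) κ₀ ≢ 0ℚ) →
      (∀ κ₀ {n} κ → n < K → (n , κ) ≢ (n₀ , κ₀) → Cleared n ⊎ linkStretchAt B (M κ₀) n (suc n % K) κ ≡ 0ℚ) →
      Cleared n₀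
    cleared-by M _ stretched others e₀ refl =
      selfStress-vanishes-at G (ringRealization B) {ω} ω-stress N e₀
        (stretched κ₀ ∘ trans (sym (stretch-ring B (M κ₀) e₀))) unstretched
      where
      κ₀ : Fin 8
      κ₀ = kindOf e₀
      N : Realization (nV G)
      N = ringRealization (M κ₀)
      unstretched : ∀ e → e ≢ e₀ → ω e * stretch (ringRealization B) N (ends G e) ≡ 0ℚ
      unstretched e e≢e₀ with others κ₀ (kindOf e) (toℕ<n _) (e≢e₀ ∘ linkEdgeOf-injective)
      ... | inj₁ cleared = trans (cong (_* _) (cleared e refl)) (ℚP.*-zeroˡ (stretch (ringRealization B) N (ends G e)))
      ... | inj₂ still   = trans (cong (ω e *_) (trans (stretch-ring B (M κ₀) e) still)) (ℚP.*-zeroʳ (ω e))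

    propagate-by : ∀ {m n} → m < K → suc m % K ≡ n → suc n % K ≢ n → (A : Fin 8 → Block) →
      (∀ κ₀ → Isolates (linkStretch (B n) (B (suc n % K)) (A κ₀) rest) κ₀) →
      Cleared m → Cleared n
    propagate-by {m} {n} m<K m↦n n↦̸n A isolating m-cleared = cleared-by M n stretched unstretched
      where
      M : Fin 8 → ℕ → Block
      M κ₀ = blockMotion n (A κ₀)
      at-n : ∀ κ₀ κ → linkStretchAt B (M κ₀) n (suc n % K) κ ≡ linkStretch (B n) (B (suc n % K)) (A κ₀) rest κ
      at-n κ₀ κ = cong₂ (λ V V' → linkStretch (B n) (B (suc n % K)) V V' κ)
                        (blockMotion-≡ n (A κ₀)) (blockMotion-≢ (A κ₀) n↦̸n)
      stretched : ∀ κ₀ → linkStretchAt B (M κ₀) n (suc n % K) κ₀ ≢ 0ℚ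
      stretched κ₀ = proj₁ (isolating κ₀) ∘ trans (sym (at-n κ₀ κ₀))
      unstretched : ∀ κ₀ {l} κ → l < K → (l , κ) ≢ (n , κ₀) →
                    Cleared l ⊎ linkStretchAt B (M κ₀) l (suc l % K) κ ≡ 0ℚ
      unstretched κ₀ {l} κ l<K l,κ≢n,κ₀ with l ℕ.≟ n
      ... | yes refl = inj₂ (trans (at-n κ₀ κ) (proj₂ (isolating κ₀) κ (l,κ≢n,κ₀ ∘ cong (l ,_))))
      ... | no l≢n with suc l % K ℕ.≟ n
      ...   | yes l↦n = inj₁ (subst Cleared (sucMod-injective m<K l<K (trans m↦n (sym l↦n))) m-cleared)
      ...   | no l↦̸n  = inj₂ (linkStretch-still (B l) (B (suc l % K)) {V' = M κ₀ (suc l % K)} (blockMotion-≢ (A κ₀) l≢n)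
                                 (rest-still (blockMotion-≢ (A κ₀) l↦̸n) 0F) (rest-still (blockMotion-≢ (A κ₀) l↦̸n) 1F) κ)

  module _ (6≤K : 6 ≤ K) {ω : Fin (nE G) → ℚ} (ω-stress : IsSelfStress G (ringRealization position) ω) where
    open Clearing position {ω} ω-stress

    window-clears : Cleared 1
    window-clears = cleared-by window 1 stretched unstretched
      where
      1+n%K : ∀ {n} → n < 5 → suc n % K ≡ suc n
      1+n%K n<5 = m≤n⇒m%n≡m (ℕP.≤-trans n<5 (ℕP.≤-pred 6≤K))
      stretched : ∀ κ₀ → linkStretchAt position (window κ₀) 1 (2 % K) κ₀ ≢ 0ℚ
      stretched κ₀ = subst (λ n' → linkStretchAt position (window κ₀) 1 n' κ₀ ≢ 0ℚ) (sym (1+n%K (s≤s (s≤s z≤n))))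
                       (proj₁ (WindowIsolates.link₁ (window-isolates κ₀)))
      in-window : ∀ κ₀ {n} κ → n < 5 → (n , κ) ≢ (1 , κ₀) → linkStretchAt position (window κ₀) n (suc n) κ ≡ 0ℚ
      in-window κ₀ {n} κ n<5 n,κ≢1,κ₀ with n ℕ.≟ 1
      ... | yes refl = proj₂ (WindowIsolates.link₁ (window-isolates κ₀)) κ (n,κ≢1,κ₀ ∘ cong (1 ,_))
      ... | no n≢1   = WindowIsolates.others (window-isolates κ₀) n<5 n≢1 κ
      beyond-window : ∀ κ₀ {n} κ → n < K → 5 ≤ n → linkStretchAt position (window κ₀) n (suc n % K) κ ≡ 0ℚ
      beyond-window κ₀ {n} κ n<K 5≤n with suc n % K | sucMod n<K
      ... | _ | no-wrap _ =
        linkStretch-still (position n) (position (suc n)) {V' = window κ₀ (suc n)} (window-beyond κ₀ 5≤n)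
          (rest-still next-rest 0F) (rest-still next-rest 1F) κ
        where
        next-rest : window κ₀ (suc n) ≡ rest
        next-rest = window-beyond κ₀ (ℕP.m≤n⇒m≤1+n 5≤n)
      ... | _ | wrap _ =
        linkStretch-still (position n) (position 0) {V' = window κ₀ 0} (window-beyond κ₀ 5≤n)
          (WindowIsolates.a₀-still (window-isolates κ₀)) (WindowIsolates.b₀-still (window-isolates κ₀)) κ
      unstretched : ∀ κ₀ {n} κ → n < K → (n , κ) ≢ (1 , κ₀) →
                    Cleared n ⊎ linkStretchAt position (window κ₀) n (suc n % K) κ ≡ 0ℚ
      unstretched κ₀ {n} κ n<K n,κ≢1,κ₀ with n ℕ.<? 5
      ... | yes n<5 = inj₂ (trans (cong (λ n' → linkStretchAt position (window κ₀) n n' κ) (1+n%K n<5))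
                                  (in-window κ₀ κ n<5 n,κ≢1,κ₀))
      ... | no n≮5  = inj₂ (beyond-window κ₀ κ n<K (ℕP.≮⇒≥ n≮5))

    propagate : ∀ {m n} → m < K → suc m % K ≡ n → n ≢ 1 → Cleared m → Cleared n
    propagate {m} {n} m<K m↦n n≢1 =
      propagate-by m<K m↦n (sucMod-≢ (ℕP.≤-trans (s≤s (s≤s z≤n)) 6≤K) n<K)
        (pinnedMotion (position n) (position (suc n % K))) (pinned-isolating (shape-↝-step 6≤K n<K n≢1))
      where
      n<K : n < K
      n<K = subst (_< K) m↦n (m%n<n (suc m) K)

    cleared-suc : ∀ d → suc d < K → Cleared (suc d)
    cleared-suc 0       _     = window-clears
    cleared-suc (suc d) 2+d<K = propagate 1+d<K (m≤n⇒m%n≡m (ℕP.≤-pred 2+d<K)) (λ ()) (cleared-suc d 1+d<K)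
      where
      1+d<K : suc d < K
      1+d<K = ℕP.<-trans (ℕP.n<1+n (suc d)) 2+d<K

    cleared : ∀ n → n < K → Cleared n
    cleared 0       _ = propagate (ℕP.n<1+n k) (n%n≡0 K) (λ ()) (cleared-positive 0<k (ℕP.n<1+n k))
      where
      0<k : 0 < k
      0<k = ℕP.≤-trans (s≤s z≤n) (ℕP.≤-pred 6≤K)
      cleared-positive : ∀ {n} → 0 < n → n < K → Cleared n
      cleared-positive {suc d} _ = cleared-suc d
    cleared (suc d) = cleared-suc d

    stress-free : ∀ e → ω e ≡ 0ℚ
    stress-free e = cleared (linkOf e) (toℕ<n _) e refl

lemma3 : (G : Graph) (k : ℕ) → 6 ≤ k → IsRingOfButterflies G k → Independent3 G
lemma3 G (suc k) 6≤K ring = ringRealization position , λ ω ω-stress → stress-free 6≤K ω-stress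
  where open RingOfButterflies ring
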